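{- Let $H_{\mathrm{cor},\mathbb{F}_3}$ be the corner hypergraph of the group $\mathbb{F}_3=\mathbb{Z}/3\mathbb{Z}$. Then $\beta(H_{\mathrm{cor},\mathbb{F}_3})\geq 7$, and thus $\Theta(H_{\mathrm{cor},\mathbb{F}_3})\geq 7$.
   Context: A directed $k$-uniform hypergraph is a pair $H=(V,E)$ with $V$ a finite set and $E$ a set of $k$-tuples of elements of $V$. The strong product $G\boxtimes H$ of directed $k$-uniform hypergraphs $G=(V_G,E_G)$, $H=(V_H,E_H)$ has vertex set $V_G\times V_H$, and $((g_1,h_1),\dots,(g_k,h_k))$ is an edge iff either ($g_1=\dots=g_k$ and $(h_1,\dots,h_k)\in E_H$), or ($(g_1,\dots,g_k)\in E_G$ and $h_1=\dots=h_k$), or ($(g_1,\dots,g_k)\in E_G$ and $(h_1,\dots,h_k)\in E_H$). $H^{\boxtimes n}$ is the $n$-fold strong product. An independent set of $H$ is a set $S\subseteq V$ such that no edge has all its coordinates in $S$; $\alpha(H)$ is the maximum size of an independent set, and $\Theta(H)=\lim_{n\to\infty}\alpha(H^{\boxtimes n})^{1/n}$. For a finite abelian group $G$, the corner hypergraph $H_{\mathrm{cor},G}$ is the directed $3$-uniform hypergraph with vertex set $G\times G$ and edge set $\{((g_1,g_2),(g_1+\lambda,g_2),(g_1,g_2+\lambda)) : g_1,g_2,\lambda\in G,\ \lambda\neq 0\}$. Combinatorial degeneration: for finite sets $I_1,\dots,I_k$ and $\Phi\subseteq\Psi\subseteq I_1\times\dots\times I_k$, we write $\Psi\unrhd\Phi$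 if there are maps $u_i:I_i\to\mathbb{Z}$ such that $\sum_i u_i(x_i)>0$ for every $x\in\Psi\setminus\Phi$ and $\sum_i u_i(x_i)=0$ for every $x\in\Phi$. For $H=(V,E)$, $\beta(H)$ is the largest size of $S\subseteq V$ with $E\cup\{(v,\dots,v):v\in V\}\unrhd\{(v,\dots,v):v\in S\}$. -}

module Defs where

open import Level using (0ℓ)
open import Data.Nat as ℕ using (ℕ; zero; suc; _%_; _^_)
open import Data.Nat.DivMod using (m%n<n)
open import Data.Fin as Fin using (Fin; toℕ; fromℕ<)
open import Data.Integer as ℤ using (ℤ; +_)
open import Data.Product using (Σ; _×_; _,_)
open import Data.Sum using (_⊎_)
open import Data.Unit using (⊤; tt)
open import Data.Empty using (⊥)
open import Data.List using (List; length)
open import Data.List.Membership.Propositional using (_∈_)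
open import Data.List.Relation.Unary.Unique.Propositional using (Unique)
open import Relation.Binary.PropositionalEquality using (_≡_; _≢_)
open import Relation.Nullary using (¬_)

record Hypergraph3 : Set₁ where
  field
    V    : Set
    Edge : V → V → V → Set
open Hypergraph3 public

_⊠_ : Hypergraph3 → Hypergraph3 → Hypergraph3
G ⊠ H = record
  { V    = V G × V H
  ; Edge = λ { (g₁ , h₁) (g₂ , h₂) (g₃ , h₃) →
               ((g₁ ≡ g₂) × (g₂ ≡ g₃) × Edge H h₁ h₂ h₃)
             ⊎ (Edge G g₁ g₂ g₃ × (h₁ ≡ h₂) × (h₂ ≡ h₃))
             ⊎ (Edge G g₁ g₂ g₃ × Edge H h₁ h₂ h₃) }
  }

point : Hypergraph3
point = record { V = ⊤ ; Edge = λ _ _ _ → ⊥ }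

_^⊠_ : Hypergraph3 → ℕ → Hypergraph3
H ^⊠ zero  = point
H ^⊠ suc n = (H ^⊠ n) ⊠ H

IsIndependent : (H : Hypergraph3) → List (V H) → Set
IsIndependent H S = ∀ x y z → x ∈ S → y ∈ S → z ∈ S → ¬ Edge H x y z

αAtLeast : Hypergraph3 → ℕ → Set
αAtLeast H m = Σ (List (V H)) λ S → Unique S × IsIndependent H S × (m ℕ.≤ length S)

-- Combinatorial degeneration  E ∪ {(v,v,v) : v ∈ V}  ⊵  {(v,v,v) : v ∈ S}.
Diag : (H : Hypergraph3) → V H → V H → V H → Set
Diag H x y z = (x ≡ y) × (y ≡ z)

InΨ : (H : Hypergraph3) → V H → V H → V H → Set
InΨ H x y z = Edge H x y z ⊎ Diag H x y z

InΦ : (H : Hypergraph3) → List (V H) → V H → V H → V H → Set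
InΦ H S x y z = Diag H x y z × (x ∈ S)

DegeneratesToDiag : (H : Hypergraph3) → List (V H) → Set
DegeneratesToDiag H S =
  Σ (V H → ℤ) λ u₁ → Σ (V H → ℤ) λ u₂ → Σ (V H → ℤ) λ u₃ →
    (∀ x y z → InΨ H x y z → ¬ InΦ H S x y z → + 0 ℤ.< (u₁ x ℤ.+ u₂ y ℤ.+ u₃ z))
  × (∀ x y z → InΦ H S x y z → u₁ x ℤ.+ u₂ y ℤ.+ u₃ z ≡ + 0)

βAtLeast : Hypergraph3 → ℕ → Set
βAtLeast H m = Σ (List (V H)) λ S → Unique S × DegeneratesToDiag H S × (m ℕ.≤ length S)

F3 : Set
F3 = Fin 3

_⊕_ : F3 → F3 → F3
a ⊕ b = fromℕ< (m%n<n (toℕ a ℕ.+ toℕ b) 3)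

zero3 : F3
zero3 = Fin.zero

Hcor3 : Hypergraph3
Hcor3 = record
  { V    = F3 × F3
  ; Edge = λ { (a₁ , a₂) (b₁ , b₂) (c₁ , c₂) →
               Σ F3 λ l → (l ≢ zero3) × (b₁ ≡ a₁ ⊕ l) × (b₂ ≡ a₂)
                        × (c₁ ≡ a₁) × (c₂ ≡ a₂ ⊕ l) }
  }

-- Θ(H) ≥ r (r = p/q positive rational, here used with r = 7):
-- for every rational s = a/b < r, eventually α(H^{⊠n}) ≥ s^n,
-- i.e. liminf α(H^{⊠n})^{1/n} ≥ r.
ΘAtLeast : Hypergraph3 → ℕ → Set
ΘAtLeast H r = ∀ (a b : ℕ) → 0 ℕ.< b → a ℕ.< r ℕ.* b →
  Σ ℕ λ N → ∀ n → N ℕ.≤ n →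
    Σ (List (V (H ^⊠ n))) λ S → Unique S × IsIndependent (H ^⊠ n) S
                              × (a ^ n ℕ.≤ b ^ n ℕ.* length S)

-- Explicit weights u₁, u₂, u₃ on F₃ × F₃ exhibit the combinatorial degeneration
-- E ∪ diag ⊵ diag(S) for a 7-element S (checked by evaluation), which gives β ≥ 7.
-- Summing weights coordinatewise, the degeneration tensorises to H^⊠n and Sⁿ. On a common
-- level set of (u₁ , u₂) in Sⁿ the weight of a triple (x , y , z) equals that of (z , z , z),
-- namely 0, whereas edges have positive weight: level sets are independent. Since u₁ and u₂
-- take at most 7n + 1 values on Sⁿ, some level set has ≥ 7ⁿ / (7n + 1)² elements, which
-- eventually exceeds sⁿ for every s < 7.
module Submission where

open import Defs
open import Data.Product using (_×_; _,_; ∃-syntax)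
open import Data.Product.Properties using (≡-dec)
open import Data.Nat using (ℕ; zero; suc; _+_; _*_; _^_; _≤_; _<_; _≤?_; _≤′_; ≤′-refl; ≤′-step; z≤n; s≤s; NonZero)
import Data.Nat.Properties as ℕ
open import Data.Nat.Tactic.RingSolver using (solve-∀)
open import Data.Integer as ℤ using (ℤ; +_)
import Data.Integer.Properties as ℤ
import Data.Integer.Tactic.RingSolver as ℤ
open import Data.Fin using (Fin; #_)
open import Data.Fin.Properties using (all?) renaming (_≟_ to _≟ᶠ_)
open import Data.Unit using (tt)
open import Data.Sum using (inj₁; inj₂)
open import Data.List using (List; []; _∷_; _++_; length; filter; cartesianProduct; map)
import Data.List.Properties as List
open import Data.List.Membership.Propositional using (_∈_; _∉_)
open import Data.List.Membership.Propositional.Properties using (∈-filter⁻; ∈-cartesianProduct⁻)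
open import Data.List.Membership.DecPropositional (≡-dec (_≟ᶠ_ {3}) (_≟ᶠ_ {3})) using (_∈?_)
open import Data.List.Relation.Unary.All as All using (All; [])
open import Data.List.Relation.Unary.AllPairs using ([]; _∷_; allPairs?)
open import Data.List.Relation.Unary.Unique.Propositional using (Unique)
import Data.List.Relation.Unary.Unique.Propositional.Properties as Unique
open import Data.List.Relation.Binary.Sublist.Propositional.Properties using (filter-⊆; filter⁺; length-mono-≤)
open import Data.Vec using (Vec; []; _∷_; lookup)
open import Function using (id; _∘_)
open import Relation.Binary.PropositionalEquality using (_≡_; refl; sym; trans; cong; cong₂; subst; module ≡-Reasoning)
open import Relation.Nullary using (¬_; Dec; yes; no; ¬?; map′)
open import Relation.Nullary.Decidable using (from-yes; _→-dec_)
open import Relation.Unary using (Decidable)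

record Weighting (X : Set) : Set where
  field
    u₁ u₂ : X → ℕ
    u₃    : X → ℤ

  weight : X → X → X → ℤ
  weight x y z = + u₁ x ℤ.+ + u₂ y ℤ.+ u₃ z

open Weighting

Bounded : ∀ {X} → ℕ → Weighting X → Set
Bounded M w = (∀ x → u₁ w x ≤ M) × (∀ x → u₂ w x ≤ M)

-- The paper's degeneration E ∪ diag ⊵ diag(S), restricted to S³, with u₁ u₂ natural-valued
-- so that the level sets of (u₁ , u₂) can be pigeonholed.
record IsDegeneration (H : Hypergraph3) (S : List (V H)) (w : Weighting (V H)) : Set where
  field
    edge-pos  : ∀ {x y z} → x ∈ S → y ∈ S → z ∈ S → Edge H x y z → + 0 ℤ.< weight w x y z
    diag-zero : ∀ {x} → x ∈ S → weight w x x x ≡ + 0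

open IsDegeneration

_⊗_ : ∀ {X Y} → Weighting X → Weighting Y → Weighting (X × Y)
w ⊗ w′ = record
  { u₁ = λ (x , x′) → u₁ w x + u₁ w′ x′
  ; u₂ = λ (x , x′) → u₂ w x + u₂ w′ x′
  ; u₃ = λ (x , x′) → u₃ w x ℤ.+ u₃ w′ x′
  }

weight-⊗ : ∀ {X Y} (w : Weighting X) (w′ : Weighting Y) x x′ y y′ z z′ →
           weight (w ⊗ w′) (x , x′) (y , y′) (z , z′) ≡ weight w x y z ℤ.+ weight w′ x′ y′ z′
weight-⊗ w w′ x x′ y y′ z z′ rewrite ℤ.pos-+ (u₁ w x) (u₁ w′ x′) | ℤ.pos-+ (u₂ w y) (u₂ w′ y′) =
  regroup (+ u₁ w x) (+ u₁ w′ x′) (+ u₂ w y) (+ u₂ w′ y′) (u₃ w z) (u₃ w′ z′)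
  where
  regroup : ∀ p p′ q q′ r r′ →
            p ℤ.+ p′ ℤ.+ (q ℤ.+ q′) ℤ.+ (r ℤ.+ r′) ≡ p ℤ.+ q ℤ.+ r ℤ.+ (p′ ℤ.+ q′ ℤ.+ r′)
  regroup = ℤ.solve-∀

⊗-bounded : ∀ {X Y M M′} {w : Weighting X} {w′ : Weighting Y} →
            Bounded M w → Bounded M′ w′ → Bounded (M + M′) (w ⊗ w′)
⊗-bounded (b₁ , b₂) (b₁′ , b₂′) =
  (λ (x , x′) → ℕ.+-mono-≤ (b₁ x) (b₁′ x′)) , (λ (x , x′) → ℕ.+-mono-≤ (b₂ x) (b₂′ x′))

⊠-isDegeneration : ∀ {G H SG SH wG wH} → IsDegeneration G SG wG → IsDegeneration H SH wH →
                   IsDegeneration (G ⊠ H) (cartesianProduct SG SH) (wG ⊗ wH)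
⊠-isDegeneration {G} {H} {SG} {SH} {wG} {wH} DG DH = record { edge-pos = pos ; diag-zero = zero-on }
  where
  zero-on : ∀ {x} → x ∈ cartesianProduct SG SH → weight (wG ⊗ wH) x x x ≡ + 0
  zero-on {x , x′} m with ∈-cartesianProduct⁻ SG SH m
  ... | mx , mx′ = trans (weight-⊗ wG wH x x′ x x′ x x′) (cong₂ ℤ._+_ (diag-zero DG mx) (diag-zero DH mx′))

  pos : ∀ {x y z} → x ∈ cartesianProduct SG SH → y ∈ cartesianProduct SG SH → z ∈ cartesianProduct SG SH →
        Edge (G ⊠ H) x y z → + 0 ℤ.< weight (wG ⊗ wH) x y z
  pos {x , x′} {y , y′} {z , z′} mx my mz e
    with ∈-cartesianProduct⁻ SG SH mx | ∈-cartesianProduct⁻ SG SH my | ∈-cartesianProduct⁻ SG SH mz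
  ... | gx , hx | gy , hy | gz , hz rewrite weight-⊗ wG wH x x′ y y′ z z′ with e
  ... | inj₁ (refl , refl , eH) =
    ℤ.+-mono-≤-< (ℤ.≤-reflexive (sym (diag-zero DG gx))) (edge-pos DH hx hy hz eH)
  ... | inj₂ (inj₁ (eG , refl , refl)) =
    ℤ.+-mono-<-≤ (edge-pos DG gx gy gz eG) (ℤ.≤-reflexive (sym (diag-zero DH hx)))
  ... | inj₂ (inj₂ (eG , eH)) =
    ℤ.+-mono-< (edge-pos DG gx gy gz eG) (edge-pos DH hx hy hz eH)

length-cartesianProduct : ∀ {A B : Set} (xs : List A) (ys : List B) →
                          length (cartesianProduct xs ys) ≡ length xs * length ys
length-cartesianProduct []       ys = refl
length-cartesianProduct (x ∷ xs) ys = begin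
  length (map (x ,_) ys ++ cartesianProduct xs ys) ≡⟨ List.length-++ (map (x ,_) ys) ⟩
  length (map (x ,_) ys) + length (cartesianProduct xs ys)
    ≡⟨ cong₂ _+_ (List.length-map (x ,_) ys) (length-cartesianProduct xs ys) ⟩
  length ys + length xs * length ys ∎
  where open ≡-Reasoning

module Power (H : Hypergraph3) where

  _^ˡ_ : List (V H) → (n : ℕ) → List (V (H ^⊠ n))
  S ^ˡ zero  = tt ∷ []
  S ^ˡ suc n = cartesianProduct (S ^ˡ n) S

  _^ʷ_ : Weighting (V H) → (n : ℕ) → Weighting (V (H ^⊠ n))
  w ^ʷ zero  = record { u₁ = λ _ → 0 ; u₂ = λ _ → 0 ; u₃ = λ _ → + 0 }
  w ^ʷ suc n = (w ^ʷ n) ⊗ w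

  length-^ˡ : ∀ S n → length (S ^ˡ n) ≡ length S ^ n
  length-^ˡ S zero    = refl
  length-^ˡ S (suc n) = begin
    length (cartesianProduct (S ^ˡ n) S) ≡⟨ length-cartesianProduct (S ^ˡ n) S ⟩
    length (S ^ˡ n) * length S           ≡⟨ cong (_* length S) (length-^ˡ S n) ⟩
    length S ^ n * length S              ≡⟨ ℕ.*-comm (length S ^ n) (length S) ⟩
    length S ^ suc n                     ∎
    where open ≡-Reasoning

  ^ˡ-unique : ∀ {S} → Unique S → ∀ n → Unique (S ^ˡ n)
  ^ˡ-unique uS zero    = [] ∷ []
  ^ˡ-unique uS (suc n) = Unique.cartesianProduct⁺ (^ˡ-unique uS n) uS

  ^ʷ-bounded : ∀ {M w} → Bounded M w → ∀ n → Bounded (n * M) (w ^ʷ n)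
  ^ʷ-bounded b zero            = (λ _ → z≤n) , (λ _ → z≤n)
  ^ʷ-bounded {M} {w} b (suc n) =
    subst (λ k → Bounded k (w ^ʷ suc n)) (ℕ.+-comm (n * M) M)
          (⊗-bounded {w = w ^ʷ n} {w′ = w} (^ʷ-bounded b n) b)

  ^-isDegeneration : ∀ {S w} → IsDegeneration H S w → ∀ n → IsDegeneration (H ^⊠ n) (S ^ˡ n) (w ^ʷ n)
  ^-isDegeneration D zero    = record { edge-pos = λ _ _ _ () ; diag-zero = λ _ → refl }
  ^-isDegeneration D (suc n) = ⊠-isDegeneration (^-isDegeneration D n) D

module _ {A : Set} where

  length-filter-split : ∀ {P : A → Set} (P? : Decidable P) xs →
                        length xs ≡ length (filter P? xs) + length (filter (¬? ∘ P?) xs)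
  length-filter-split P? []       = refl
  length-filter-split P? (x ∷ xs) with P? x
  ... | yes _ = cong suc (length-filter-split P? xs)
  ... | no _  = trans (cong suc (length-filter-split P? xs)) (sym (ℕ.+-suc _ _))

  fiber : (A → ℕ) → ℕ → List A → List A
  fiber f i = filter (λ x → f x ℕ.≟ i)

  pigeonhole : ∀ (f : A → ℕ) m xs → All (λ x → f x ≤ m) xs →
               ∃[ i ] length xs ≤ suc m * length (fiber f i xs)
  pigeonhole f zero xs bound = 0 , ℕ.≤-reflexive (begin
    length xs                ≡⟨ cong length (sym (List.filter-all (λ x → f x ℕ.≟ 0) (All.map ℕ.n≤0⇒n≡0 bound))) ⟩
    length (fiber f 0 xs)    ≡⟨ sym (ℕ.*-identityˡ _) ⟩
    1 * length (fiber f 0 xs) ∎)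
    where open ≡-Reasoning
  pigeonhole f (suc m) xs bound = extend (pigeonhole f m rest rest-bound)
    where
    top?  = λ x → f x ℕ.≟ suc m
    rest  = filter (¬? ∘ top?) xs

    rest-bound : All (λ x → f x ≤ m) rest
    rest-bound = All.tabulate λ x∈rest → let (x∈xs , f≢) = ∈-filter⁻ (¬? ∘ top?) x∈rest in
      ℕ.≤-pred (ℕ.≤∧≢⇒< (All.lookup bound x∈xs) f≢)

    fiber-rest≤ : ∀ i → length (fiber f i rest) ≤ length (fiber f i xs)
    fiber-rest≤ i = length-mono-≤ (filter⁺ _ _ (λ { refl → id }) (filter-⊆ (¬? ∘ top?) xs))

    dominated-by : ∀ {i} j → length rest ≤ suc m * length (fiber f i rest) →
                   length (fiber f (suc m) xs) ≤ length (fiber f j xs) →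
                   length (fiber f i xs) ≤ length (fiber f j xs) →
                   length xs ≤ suc (suc m) * length (fiber f j xs)
    dominated-by {i} j large top≤ i≤ = begin
      length xs                                          ≡⟨ length-filter-split top? xs ⟩
      length (fiber f (suc m) xs) + length rest          ≤⟨ ℕ.+-monoʳ-≤ (length (fiber f (suc m) xs)) large ⟩
      length (fiber f (suc m) xs) + suc m * length (fiber f i rest)
        ≤⟨ ℕ.+-mono-≤ top≤ (ℕ.*-monoʳ-≤ (suc m) (ℕ.≤-trans (fiber-rest≤ i) i≤)) ⟩
      length (fiber f j xs) + suc m * length (fiber f j xs) ∎
      where open ℕ.≤-Reasoning

    extend : ∃[ i ] length rest ≤ suc m * length (fiber f i rest) →
             ∃[ i ] length xs ≤ suc (suc m) * length (fiber f i xs)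
    extend (i , large) with length (fiber f (suc m) xs) ≤? length (fiber f i xs)
    ... | yes top≤ = i , dominated-by i large top≤ ℕ.≤-refl
    ... | no top≰  = suc m , dominated-by (suc m) large ℕ.≤-refl (ℕ.<⇒≤ (ℕ.≰⇒> top≰))

levelSet : ∀ {X} → Weighting X → List X → ℕ → ℕ → List X
levelSet w S i j = fiber (u₂ w) j (fiber (u₁ w) i S)

module _ {X} (w : Weighting X) (S : List X) where

  ∈-levelSet⁻ : ∀ {i j x} → x ∈ levelSet w S i j → x ∈ S × u₁ w x ≡ i × u₂ w x ≡ j
  ∈-levelSet⁻ {i} {j} m =
    let (m′ , x₂≡j) = ∈-filter⁻ (λ x → u₂ w x ℕ.≟ j) m
        (x∈S , x₁≡i) = ∈-filter⁻ (λ x → u₁ w x ℕ.≟ i) m′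
    in x∈S , x₁≡i , x₂≡j

  levelSet-unique : Unique S → ∀ i j → Unique (levelSet w S i j)
  levelSet-unique uS i j = Unique.filter⁺ (λ x → u₂ w x ℕ.≟ j) (Unique.filter⁺ (λ x → u₁ w x ℕ.≟ i) uS)

  large-levelSet : ∀ {M} → Bounded M w →
                   ∃[ i ] ∃[ j ] length S ≤ suc M * (suc M * length (levelSet w S i j))
  large-levelSet {M} (b₁ , b₂) =
    let (i , large₁) = pigeonhole (u₁ w) M S (All.tabulate λ {x} _ → b₁ x)
        (j , large₂) = pigeonhole (u₂ w) M (fiber (u₁ w) i S) (All.tabulate λ {x} _ → b₂ x)
    in i , j , ℕ.≤-trans large₁ (ℕ.*-monoʳ-≤ (suc M) large₂)

levelSet-independent : ∀ {H S w} → IsDegeneration H S w → ∀ i j → IsIndependent H (levelSet w S i j)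
levelSet-independent {H} {S} {w} D i j x y z mx my mz e
  with ∈-levelSet⁻ w S mx | ∈-levelSet⁻ w S my | ∈-levelSet⁻ w S mz
... | x∈S , x₁≡i , _ | y∈S , _ , y₂≡j | z∈S , z₁≡i , z₂≡j =
  ℤ.<-irrefl (sym weight≡0) (edge-pos D x∈S y∈S z∈S e)
  where
  weight≡0 : weight w x y z ≡ + 0
  weight≡0 = trans (cong₂ (λ p q → + p ℤ.+ + q ℤ.+ u₃ w z) (trans x₁≡i (sym z₁≡i)) (trans y₂≡j (sym z₂≡j)))
                   (diag-zero D z∈S)

-- With K = 1 + k:  (1 + 1/K)³ ≤ 1 + 7/K ≤ 1 + 1/a  once K ≥ 7a.
cube-step : ∀ a k → 7 * a ≤ suc k →
            a * (suc (suc k) * suc (suc k) * suc (suc k)) ≤ suc a * (suc k * suc k * suc k)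
cube-step a k 7a≤K = begin
  a * (suc K * suc K * suc K)                             ≡⟨ expand a K ⟩
  a * (K * K * K) + (a * (3 * K + 1) + 3 * a * (K * K))
    ≤⟨ ℕ.+-monoʳ-≤ (a * (K * K * K)) (ℕ.+-monoˡ-≤ (3 * a * (K * K)) (ℕ.*-monoʳ-≤ a linear≤square)) ⟩
  a * (K * K * K) + (a * (4 * (K * K)) + 3 * a * (K * K)) ≡⟨ collect a K ⟩
  a * (K * K * K) + 7 * a * (K * K)
    ≤⟨ ℕ.+-monoʳ-≤ (a * (K * K * K)) (ℕ.*-monoˡ-≤ (K * K) 7a≤K) ⟩
  a * (K * K * K) + K * (K * K)                           ≡⟨ absorb a K ⟩
  suc a * (K * K * K)                                     ∎
  where
  open ℕ.≤-Reasoning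
  K = suc k
  expand : ∀ x y → x * (suc y * suc y * suc y) ≡ x * (y * y * y) + (x * (3 * y + 1) + 3 * x * (y * y))
  expand = solve-∀
  collect : ∀ x y → x * (y * y * y) + (x * (4 * (y * y)) + 3 * x * (y * y)) ≡ x * (y * y * y) + 7 * x * (y * y)
  collect = solve-∀
  absorb : ∀ x y → x * (y * y * y) + y * (y * y) ≡ suc x * (y * y * y)
  absorb = solve-∀
  linear≤square : 3 * K + 1 ≤ 4 * (K * K)
  linear≤square = begin
    3 * K + 1 ≤⟨ ℕ.+-monoʳ-≤ (3 * K) (s≤s z≤n) ⟩
    3 * K + K ≡⟨ ℕ.+-comm (3 * K) K ⟩
    4 * K     ≤⟨ ℕ.*-monoʳ-≤ 4 (ℕ.m≤m*n K K) ⟩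
    4 * (K * K) ∎

power-beats-cube : ∀ a {n} → 7 * a ≤′ n →
                   a ^ n * (suc n * suc n * suc n) ≤ (suc (7 * a) * suc (7 * a) * suc (7 * a)) * suc a ^ n
power-beats-cube a ≤′-refl =
  ℕ.≤-trans (ℕ.*-monoˡ-≤ C (ℕ.^-monoˡ-≤ (7 * a) (ℕ.n≤1+n a))) (ℕ.≤-reflexive (ℕ.*-comm (suc a ^ (7 * a)) C))
  where C = suc (7 * a) * suc (7 * a) * suc (7 * a)
power-beats-cube a {suc k} (≤′-step 7a≤k) = begin
  a * a ^ k * (suc (suc k) * suc (suc k) * suc (suc k))   ≡⟨ swap a (a ^ k) _ ⟩
  a ^ k * (a * (suc (suc k) * suc (suc k) * suc (suc k)))
    ≤⟨ ℕ.*-monoʳ-≤ (a ^ k) (cube-step a k (ℕ.m≤n⇒m≤1+n (ℕ.≤′⇒≤ 7a≤k))) ⟩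
  a ^ k * (suc a * (suc k * suc k * suc k))               ≡⟨ swap′ (a ^ k) (suc a) _ ⟩
  suc a * (a ^ k * (suc k * suc k * suc k))               ≤⟨ ℕ.*-monoʳ-≤ (suc a) (power-beats-cube a 7a≤k) ⟩
  suc a * (C * suc a ^ k)                                 ≡⟨ swap′ (suc a) C (suc a ^ k) ⟩
  C * (suc a * suc a ^ k)                                 ∎
  where
  open ℕ.≤-Reasoning
  C = suc (7 * a) * suc (7 * a) * suc (7 * a)
  swap : ∀ x y z → x * y * z ≡ y * (x * z)
  swap = solve-∀
  swap′ : ∀ x y z → x * (y * z) ≡ y * (x * z)
  swap′ = solve-∀

exponential-beats-quadratic : ∀ K a c → a < c →
                              ∃[ N ] ∀ n → N ≤ n → a ^ n * (suc (n * K) * suc (n * K)) ≤ c ^ n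
exponential-beats-quadratic K a c a<c = 7 * a + suc K * suc K * C , dominated
  where
  C = suc (7 * a) * suc (7 * a) * suc (7 * a)
  instance
    C≢0 : NonZero C
    C≢0 = _

  rearrange : ∀ x y z w → w * (x * (y * z * (y * z))) ≡ x * (z * z) * (y * y * w)
  rearrange = solve-∀
  collect : ∀ x z → x * (z * z) * z ≡ x * (z * z * z)
  collect = solve-∀

  dominated : ∀ n → 7 * a + suc K * suc K * C ≤ n → a ^ n * (suc (n * K) * suc (n * K)) ≤ c ^ n
  dominated n N≤n = ℕ.*-cancelˡ-≤ C (begin
    C * (a ^ n * (suc (n * K) * suc (n * K)))          ≤⟨ ℕ.*-monoʳ-≤ C (ℕ.*-monoʳ-≤ (a ^ n) (ℕ.*-mono-≤ q≤ q≤)) ⟩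
    C * (a ^ n * (suc K * suc n * (suc K * suc n)))    ≡⟨ rearrange (a ^ n) (suc K) (suc n) C ⟩
    a ^ n * (suc n * suc n) * (suc K * suc K * C)      ≤⟨ ℕ.*-monoʳ-≤ (a ^ n * (suc n * suc n)) KKC≤n ⟩
    a ^ n * (suc n * suc n) * suc n                    ≡⟨ collect (a ^ n) (suc n) ⟩
    a ^ n * (suc n * suc n * suc n)                    ≤⟨ power-beats-cube a (ℕ.≤⇒≤′ (ℕ.m+n≤o⇒m≤o (7 * a) N≤n)) ⟩
    C * suc a ^ n                                      ≤⟨ ℕ.*-monoʳ-≤ C (ℕ.^-monoˡ-≤ n a<c) ⟩
    C * c ^ n                                          ∎)
    where
    open ℕ.≤-Reasoning
    q≤ : suc (n * K) ≤ suc K * suc n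
    q≤ = s≤s (ℕ.≤-trans (ℕ.≤-reflexive (ℕ.*-comm n K))
                        (ℕ.≤-trans (ℕ.*-monoʳ-≤ K (ℕ.n≤1+n n)) (ℕ.m≤n+m (K * suc n) n)))
    KKC≤n : suc K * suc K * C ≤ suc n
    KKC≤n = ℕ.m≤n⇒m≤1+n (ℕ.m+n≤o⇒n≤o (7 * a) N≤n)

^-distribʳ-* : ∀ m n o → (m * n) ^ o ≡ m ^ o * n ^ o
^-distribʳ-* m n zero    = refl
^-distribʳ-* m n (suc o) = trans (cong (m * n *_) (^-distribʳ-* m n o)) (interchange m n (m ^ o) (n ^ o))
  where
  interchange : ∀ x y z w → x * y * (z * w) ≡ x * z * (y * w)
  interchange = solve-∀

cancel-square : ∀ a b r q L n → a ^ n * (suc q * suc q) ≤ (r * b) ^ n → r ^ n ≤ suc q * (suc q * L) →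
                a ^ n ≤ b ^ n * L
cancel-square a b r q L n small large = ℕ.*-cancelˡ-≤ (suc q * suc q) (begin
  suc q * suc q * a ^ n        ≡⟨ ℕ.*-comm (suc q * suc q) (a ^ n) ⟩
  a ^ n * (suc q * suc q)      ≤⟨ small ⟩
  (r * b) ^ n                  ≡⟨ ^-distribʳ-* r b n ⟩
  r ^ n * b ^ n                ≤⟨ ℕ.*-monoˡ-≤ (b ^ n) large ⟩
  suc q * (suc q * L) * b ^ n  ≡⟨ regroup (suc q) L (b ^ n) ⟩
  suc q * suc q * (b ^ n * L)  ∎)
  where
  open ℕ.≤-Reasoning
  regroup : ∀ x y z → x * (x * y) * z ≡ x * x * (z * y)
  regroup = solve-∀

degeneration⇒ΘAtLeast : ∀ {H S w M} → IsDegeneration H S w → Unique S → Bounded M w → ΘAtLeast H (length S)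
degeneration⇒ΘAtLeast {H} {S} {w} {M} D uS bounded a b _ a<rb =
  let (N , dominated) = exponential-beats-quadratic M a (length S * b) a<rb in
  N , λ n N≤n →
    let (i , j , large) = large-levelSet (w ^ʷ n) (S ^ˡ n) (^ʷ-bounded bounded n) in
    levelSet (w ^ʷ n) (S ^ˡ n) i j ,
    levelSet-unique (w ^ʷ n) (S ^ˡ n) (^ˡ-unique uS n) i j ,
    levelSet-independent (^-isDegeneration D n) i j ,
    cancel-square a b (length S) (n * M) _ n (dominated n N≤n)
                  (ℕ.≤-trans (ℕ.≤-reflexive (sym (length-^ˡ S n))) large)
  where open Power H

degeneration⇒βAtLeast : ∀ {H S} (w : Weighting (V H)) →
                        (∀ {x y z} → Edge H x y z → + 0 ℤ.< weight w x y z) →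
                        (∀ {x} → x ∈ S → weight w x x x ≡ + 0) →
                        (∀ {x} → x ∉ S → + 0 ℤ.< weight w x x x) →
                        Unique S → βAtLeast H (length S)
degeneration⇒βAtLeast {H} {S} w edge-pos diag-zero off-diag-pos uS =
  S , uS , (+_ ∘ u₁ w , +_ ∘ u₂ w , u₃ w , pos , zero-on) , ℕ.≤-refl
  where
  pos : ∀ x y z → InΨ H x y z → ¬ InΦ H S x y z → + 0 ℤ.< weight w x y z
  pos x y z (inj₁ e)             _   = edge-pos e
  pos x _ _ (inj₂ (refl , refl)) x∉Φ = off-diag-pos (λ x∈S → x∉Φ ((refl , refl) , x∈S))

  zero-on : ∀ x y z → InΦ H S x y z → weight w x y z ≡ + 0
  zero-on x _ _ ((refl , refl) , x∈S) = diag-zero x∈S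

all²? : ∀ {m n} {P : Fin m × Fin n → Set} → (∀ v → Dec (P v)) → Dec (∀ v → P v)
all²? P? = map′ (λ p (i , j) → p i j) (λ p i j → p (i , j)) (all? λ i → all? λ j → P? (i , j))

grid : ∀ {A : Set} → Vec (Vec A 3) 3 → F3 × F3 → A
grid rows (i , j) = lookup (lookup rows i) j

cornerWeighting : Weighting (F3 × F3)
cornerWeighting = record
  { u₁ = grid ((6 ∷ 7 ∷ 6 ∷ []) ∷ (7 ∷ 3 ∷ 4 ∷ []) ∷ (0 ∷ 7 ∷ 3 ∷ []) ∷ [])
  ; u₂ = grid ((3 ∷ 0 ∷ 4 ∷ []) ∷ (7 ∷ 4 ∷ 4 ∷ []) ∷ (5 ∷ 6 ∷ 3 ∷ []) ∷ [])
  ; u₃ = λ v → ℤ.- + grid ((9 ∷ 7 ∷ 10 ∷ []) ∷ (2 ∷ 7 ∷ 8 ∷ []) ∷ (5 ∷ 2 ∷ 6 ∷ []) ∷ []) v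
  }

cornerSet : List (F3 × F3)
cornerSet = (# 0 , # 0) ∷ (# 0 , # 1) ∷ (# 0 , # 2) ∷ (# 1 , # 1) ∷ (# 1 , # 2) ∷ (# 2 , # 0) ∷ (# 2 , # 2) ∷ []

cornerSet-unique : Unique cornerSet
cornerSet-unique = from-yes (allPairs? (λ v v′ → ¬? (≡-dec _≟ᶠ_ _≟ᶠ_ v v′)) cornerSet)

corner-edge-pos : ∀ {x y z} → Edge Hcor3 x y z → + 0 ℤ.< weight cornerWeighting x y z
corner-edge-pos {a₁ , a₂} (l , l≢0 , refl , refl , refl , refl) = all-corners a₁ a₂ l l≢0
  where
  all-corners : ∀ a₁ a₂ l → ¬ l ≡ zero3 →
                + 0 ℤ.< weight cornerWeighting (a₁ , a₂) (a₁ ⊕ l , a₂) (a₁ , a₂ ⊕ l)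
  all-corners = from-yes (all? λ a₁ → all? λ a₂ → all? λ l →
    ¬? (l ≟ᶠ zero3) →-dec (+ 0 ℤ.<? weight cornerWeighting (a₁ , a₂) (a₁ ⊕ l , a₂) (a₁ , a₂ ⊕ l)))

corner-diag-zero : ∀ {x} → x ∈ cornerSet → weight cornerWeighting x x x ≡ + 0
corner-diag-zero = All.lookup (from-yes (All.all? (λ v → weight cornerWeighting v v v ℤ.≟ + 0) cornerSet))

corner-off-diag-pos : ∀ {x} → x ∉ cornerSet → + 0 ℤ.< weight cornerWeighting x x x
corner-off-diag-pos {x} =
  from-yes (all²? λ v → ¬? (v ∈? cornerSet) →-dec (+ 0 ℤ.<? weight cornerWeighting v v v)) x

corner-bounded : Bounded 7 cornerWeighting
corner-bounded =
  from-yes (all²? λ v → u₁ cornerWeighting v ≤? 7) , from-yes (all²? λ v → u₂ cornerWeighting v ≤? 7)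

corner-isDegeneration : IsDegeneration Hcor3 cornerSet cornerWeighting
corner-isDegeneration = record { edge-pos = λ _ _ _ → corner-edge-pos ; diag-zero = corner-diag-zero }

theorem2p17 : βAtLeast Hcor3 7 × ΘAtLeast Hcor3 7
theorem2p17 =
    degeneration⇒βAtLeast cornerWeighting corner-edge-pos corner-diag-zero corner-off-diag-pos cornerSet-unique
  , degeneration⇒ΘAtLeast corner-isDegeneration cornerSet-unique corner-bounded
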